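{- Let $\mathcal{G}=(L,\vee,\wedge,\odot,\rightarrow,0,1)$ be an involutive right-residuated l-groupoid with derived implication $\Rightarrow$. The following are equivalent: (i) $\Rightarrow$ satisfies $[(x\Rightarrow y)\Rightarrow y]\wedge(x\vee y)=x\vee y$ for all $x,y\in L$; (ii) $x\odot y=\rceil(y\rightarrow\rceil x)$ for all $x,y\in L$; (iii) $\mathcal{G}$ satisfies condition (C).
   Context: A right-residuated l-groupoid is an algebra $(L,\vee,\wedge,\odot,\rightarrow,0,1)$ of type $(2,2,2,2,0,0)$ such that $(L,\vee,\wedge)$ is a lattice with least element $0$ and greatest element $1$, $1\odot x=x$ for all $x$, and $x\odot y\le z$ iff $x\le y\rightarrow z$ for all $x,y,z$. Put $\rceil x:=x\rightarrow 0$; $\mathcal{G}$ is involutive if $x\le y$ implies $\rceil y\le\rceil x$ and $\rceil\rceil x=x$ for all $x,y$. The derived implication is $x\Rightarrow y:=\rceil y\rightarrow\rceil x$. Condition (C): $z\le x\odot y$ iff $y\rightarrow\rceil x\le\rceil z$, for all $x,y,z$. -}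

module Defs where

open import Level using (Level; suc; _⊔_)
open import Relation.Binary.PropositionalEquality using (_≡_)
open import Algebra.Lattice.Structures using (IsLattice)
open import Data.Product using (_×_)
open import Function.Bundles using (_⇔_)

record RRLGroupoid (ℓ : Level) : Set (suc ℓ) where
  infixr 6 _∨_
  infixr 7 _∧_
  infixl 8 _⊙_
  infixr 5 _⟶_
  infix 4 _≤_
  field
    L    : Set ℓ
    _∨_  : L → L → L
    _∧_  : L → L → L
    _⊙_  : L → L → L
    _⟶_  : L → L → L
    𝟎    : L
    𝟏    : L
    isLattice : IsLattice _≡_ _∨_ _∧_

  _≤_ : L → L → Set ℓ
  x ≤ y = x ∧ y ≡ x

  field
    𝟎-least    : ∀ x → 𝟎 ≤ x
    𝟏-greatest : ∀ x → x ≤ 𝟏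
    𝟏-⊙        : ∀ x → 𝟏 ⊙ x ≡ x
    residuated : ∀ x y z → (x ⊙ y ≤ z) ⇔ (x ≤ y ⟶ z)

  ⌉_ : L → L
  ⌉ x = x ⟶ 𝟎

  _⇒_ : L → L → L
  x ⇒ y = (⌉ y) ⟶ (⌉ x)

  Involutive : Set ℓ
  Involutive = (∀ x y → x ≤ y → ⌉ y ≤ ⌉ x) × (∀ x → ⌉ (⌉ x) ≡ x)

  ConditionC : Set ℓ
  ConditionC = ∀ x y z → (z ≤ x ⊙ y) ⇔ ((y ⟶ ⌉ x) ≤ ⌉ z)

-- Since ⌉ is an order-reversing involution, a ≤ ⌉b iff b ≤ ⌉a; so (C) says
-- that x ⊙ y and ⌉(y → ⌉x) have the same lower bounds, which is (ii).
-- As y ≤ (x ⇒ y) ⇒ y always holds, (i) amounts to x ≤ (x ⇒ y) ⇒ y, and after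
-- replacing y by ⌉y residuation turns this into x ⊙ y ≤ ⌉(y → ⌉x). The reverse
-- inequality follows by applying this one to ⌉(x ⊙ y) and y and using the unit
-- x ≤ y → x ⊙ y of the residuation.
module Submission where

open import Defs
open import Level using (Level)
open import Relation.Binary.PropositionalEquality using (_≡_; sym; trans; subst)
open import Data.Product using (_×_; _,_; proj₁; proj₂)
open import Function.Bundles using (_⇔_; mk⇔; Equivalence)
import Function.Properties.Equivalence as ⇔
open import Algebra.Lattice.Bundles using (Lattice)
import Algebra.Lattice.Properties.Lattice as LatticeProperties
open import Relation.Binary.Bundles using (Poset)
open import Relation.Binary.Lattice using (IsLattice)

module RRLGroupoidProperties {ℓ : Level} (G : RRLGroupoid ℓ) where
  open RRLGroupoid G
  open Equivalence using (to; from)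

  lattice : Lattice ℓ ℓ
  lattice = record { _≈_ = _≡_ ; _∨_ = _∨_ ; _∧_ = _∧_ ; isLattice = isLattice }

  open Lattice lattice using (∧-comm)

  -- The library orders a lattice by  x ≈ x ∧ y , the symmetric form of  _≤_ .
  private
    module Order = Poset (LatticeProperties.poset lattice)
    module OrderLattice = IsLattice (LatticeProperties.∨-∧-isOrderTheoreticLattice lattice)

  ≤-refl : ∀ {x} → x ≤ x
  ≤-refl = sym Order.refl

  ≤-trans : ∀ {x y z} → x ≤ y → y ≤ z → x ≤ z
  ≤-trans p q = sym (Order.trans (sym p) (sym q))

  ≤-antisym : ∀ {x y} → x ≤ y → y ≤ x → x ≡ y
  ≤-antisym p q = Order.antisym (sym p) (sym q)

  x≤x∨y : ∀ x y → x ≤ x ∨ y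
  x≤x∨y x y = sym (proj₁ (OrderLattice.supremum x y))

  ∨-least : ∀ {x y z} → x ≤ z → y ≤ z → x ∨ y ≤ z
  ∨-least {x} {y} {z} p q = sym (proj₂ (proj₂ (OrderLattice.supremum x y)) z (sym p) (sym q))

  ≤-indirect : ∀ {a b} → (∀ z → z ≤ a ⇔ z ≤ b) → a ≡ b
  ≤-indirect {a} {b} same = ≤-antisym (to (same a) ≤-refl) (from (same b) ≤-refl)

  x≤y⇔y∧x≡x : ∀ {x y} → x ≤ y ⇔ y ∧ x ≡ x
  x≤y⇔y∧x≡x {x} {y} = mk⇔ (trans (∧-comm y x)) (trans (∧-comm x y))

  ⊙-≤⇒≤-⟶ : ∀ {x y z} → x ⊙ y ≤ z → x ≤ y ⟶ z
  ⊙-≤⇒≤-⟶ {x} {y} {z} = to (residuated x y z)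

  ≤-⟶⇒⊙-≤ : ∀ {x y z} → x ≤ y ⟶ z → x ⊙ y ≤ z
  ≤-⟶⇒⊙-≤ {x} {y} {z} = from (residuated x y z)

  x≤y⟶x⊙y : ∀ x y → x ≤ y ⟶ x ⊙ y
  x≤y⟶x⊙y x y = ⊙-≤⇒≤-⟶ ≤-refl

  module WithInvolution (involutive : Involutive) where
    ⌉-antitone : ∀ {x y} → x ≤ y → ⌉ y ≤ ⌉ x
    ⌉-antitone {x} {y} = proj₁ involutive x y

    ⌉⌉ : ∀ x → ⌉ (⌉ x) ≡ x
    ⌉⌉ = proj₂ involutive

    ≤⌉⇒≤⌉ : ∀ {a b} → a ≤ ⌉ b → b ≤ ⌉ a
    ≤⌉⇒≤⌉ {a} {b} p = subst (_≤ ⌉ a) (⌉⌉ b) (⌉-antitone p)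

    ≤⌉⇔≤⌉ : ∀ {a b} → a ≤ ⌉ b ⇔ b ≤ ⌉ a
    ≤⌉⇔≤⌉ = mk⇔ ≤⌉⇒≤⌉ ≤⌉⇒≤⌉

    ⌉≤⇒⌉≤ : ∀ {a b} → ⌉ a ≤ b → ⌉ b ≤ a
    ⌉≤⇒⌉≤ {a} {b} p = subst (⌉ b ≤_) (⌉⌉ a) (⌉-antitone p)

    x≤⌉x⟶y : ∀ x y → x ≤ ⌉ x ⟶ y
    x≤⌉x⟶y x y = ⊙-≤⇒≤-⟶ (≤-trans (≤-⟶⇒⊙-≤ x≤⌉⌉x) (𝟎-least y))
      where
      x≤⌉⌉x : x ≤ ⌉ (⌉ x)
      x≤⌉⌉x = subst (x ≤_) (sym (⌉⌉ x)) ≤-refl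

    y≤[x⇒y]⇒y : ∀ x y → y ≤ (x ⇒ y) ⇒ y
    y≤[x⇒y]⇒y x y = x≤⌉x⟶y y (⌉ (x ⇒ y))

    ⊙-LowerBound ⊙-UpperBound ⊙-Dual ⇒-Expansive : Set ℓ
    ⊙-LowerBound = ∀ x y → x ⊙ y ≤ ⌉ (y ⟶ ⌉ x)
    ⊙-UpperBound = ∀ x y → ⌉ (y ⟶ ⌉ x) ≤ x ⊙ y
    ⊙-Dual       = ∀ x y → x ⊙ y ≡ ⌉ (y ⟶ ⌉ x)
    ⇒-Expansive  = ∀ x y → x ≤ (x ⇒ y) ⇒ y

    ⇒-expansive⇔∨-absorbed : ⇒-Expansive ⇔ (∀ x y → ((x ⇒ y) ⇒ y) ∧ (x ∨ y) ≡ x ∨ y)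
    ⇒-expansive⇔∨-absorbed = mk⇔
      (λ expansive x y → to x≤y⇔y∧x≡x (∨-least (expansive x y) (y≤[x⇒y]⇒y x y)))
      (λ absorbed x y → ≤-trans (x≤x∨y x y) (from x≤y⇔y∧x≡x (absorbed x y)))

    ⇒-expansive⇔⊙-lowerBound : ⇒-Expansive ⇔ ⊙-LowerBound
    ⇒-expansive⇔⊙-lowerBound = mk⇔
      (λ expansive x y →
        ≤-⟶⇒⊙-≤ (subst (λ w → x ≤ w ⟶ ⌉ (w ⟶ ⌉ x)) (⌉⌉ y) (expansive x (⌉ y))))
      (λ lower x y → ⊙-≤⇒≤-⟶ (lower x (⌉ y)))

    ⊙-lowerBound⇒⊙-upperBound : ⊙-LowerBound → ⊙-UpperBound
    ⊙-lowerBound⇒⊙-upperBound lower x y = ⌉≤⇒⌉≤ (⊙-≤⇒≤-⟶ (≤-trans lowerAt⌉[x⊙y] ⌉[y⟶x⊙y]≤⌉x))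
      where
      lowerAt⌉[x⊙y] : ⌉ (x ⊙ y) ⊙ y ≤ ⌉ (y ⟶ x ⊙ y)
      lowerAt⌉[x⊙y] = subst (λ w → ⌉ (x ⊙ y) ⊙ y ≤ ⌉ (y ⟶ w)) (⌉⌉ (x ⊙ y)) (lower (⌉ (x ⊙ y)) y)
      ⌉[y⟶x⊙y]≤⌉x : ⌉ (y ⟶ x ⊙ y) ≤ ⌉ x
      ⌉[y⟶x⊙y]≤⌉x = ⌉-antitone (x≤y⟶x⊙y x y)

    ⊙-lowerBound⇔⊙-dual : ⊙-LowerBound ⇔ ⊙-Dual
    ⊙-lowerBound⇔⊙-dual = mk⇔
      (λ lower x y → ≤-antisym (lower x y) (⊙-lowerBound⇒⊙-upperBound lower x y))
      (λ dual x y → subst (x ⊙ y ≤_) (dual x y) ≤-refl)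

    ⊙-dual⇔conditionC : ⊙-Dual ⇔ ConditionC
    ⊙-dual⇔conditionC = mk⇔
      (λ dual x y z → subst (λ w → z ≤ w ⇔ (y ⟶ ⌉ x) ≤ ⌉ z) (sym (dual x y)) ≤⌉⇔≤⌉)
      (λ c x y → ≤-indirect λ z → ⇔.trans (c x y z) ≤⌉⇔≤⌉)

corollary1 : {ℓ : Level} (G : RRLGroupoid ℓ) → RRLGroupoid.Involutive G →
    let open RRLGroupoid G
        i   = ∀ x y → ((x ⇒ y) ⇒ y) ∧ (x ∨ y) ≡ x ∨ y
        ii  = ∀ x y → x ⊙ y ≡ ⌉ (y ⟶ ⌉ x)
        iii = ConditionC
    in (i ⇔ ii) × (ii ⇔ iii)
corollary1 G involutive =
  ⇔.trans (⇔.sym ⇒-expansive⇔∨-absorbed) (⇔.trans ⇒-expansive⇔⊙-lowerBound ⊙-lowerBound⇔⊙-dual) ,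
  ⊙-dual⇔conditionC
  where open RRLGroupoidProperties.WithInvolution G involutive
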